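{- Let $P_n$ be the path on $n$ vertices and let $x,y\ge 1$ be integers with $x+y\le n$. In the game on $P_n$ starting with $x$ ignorant agents and $y$ knowledgeable agents, Adversary can force a time of $(n-y)/2$ before Agents win (all agents knowledgeable), but no longer. In particular, the time for Agents to win $\text{BROADCAST}(P_n,x+1)$ is tightly bounded by $(n-1)/2$.
   Context: For a finite connected graph $G$, the game with $x$ ignorant and $y$ knowledgeable agents is played as follows. Setup: Adversary places $y$ knowledgeable and $x$ ignorant agents on $x+y$ distinct vertices of $G$. At each time $t=1,2,\ldots$: first Adversary selects an arbitrary connected spanning subgraph $G_t$ of $G$; then each agent either stays at its vertex or moves to a vertex adjacent to it in $G_t$. If after this move several agents are at the same vertex and at least one of them was knowledgeable at time $t-1$, all of them become knowledgeable at time $t$. Agents win once all agents are knowledgeable; time is measured in rounds. $\text{BROADCAST}(G,k)$ is the case of $1$ knowledgeable and $k-1$ ignorant agents. -}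

module Defs where

open import Data.Nat using (ℕ; suc; _<ᵇ_)
open import Data.Fin using (Fin; toℕ; _≟_)
open import Data.Bool using (Bool; true; false; _∨_; _∧_; T)
open import Data.List using (allFin)
open import Data.Bool.ListAction using (any)
open import Data.Product using (Σ; _×_)
open import Data.Sum using (_⊎_)
open import Relation.Binary.PropositionalEquality using (_≡_)
open import Relation.Binary.Construct.Closure.ReflexiveTransitive using (Star)
open import Relation.Nullary.Decidable using (⌊_⌋)

Graph : ℕ → Set₁
Graph n = Fin n → Fin n → Set

Path : (n : ℕ) → Graph n
Path n i j = (toℕ j ≡ suc (toℕ i)) ⊎ (toℕ i ≡ suc (toℕ j))

EdgeSet : ℕ → Set
EdgeSet n = Fin n → Fin n → Bool

ConnectedSpanning : {n : ℕ} → Graph n → EdgeSet n → Set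
ConnectedSpanning {n} G H =
  ((i j : Fin n) → H i j ≡ H j i) ×
  ((i j : Fin n) → T (H i j) → G i j) ×
  ((i j : Fin n) → Star (λ a b → T (H a b)) i j)

Positions : ℕ → ℕ → Set
Positions k n = Fin k → Fin n

Knowledge : ℕ → Set
Knowledge k = Fin k → Bool

LegalMove : {k n : ℕ} → EdgeSet n → Positions k n → Positions k n → Set
LegalMove {k} H p p' = (a : Fin k) → (p' a ≡ p a) ⊎ T (H (p a) (p' a))

newKnow : {k n : ℕ} → Positions k n → Knowledge k → Knowledge k
newKnow {k} p' K a = K a ∨ any (λ b → K b ∧ ⌊ p' b ≟ p' a ⌋) (allFin k)

AllKnow : {k : ℕ} → Knowledge k → Set
AllKnow {k} K = (a : Fin k) → K a ≡ true

-- AgentsWinWithin G T p K : from the current configuration (positions p,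
-- knowledge K), Agents have a strategy guaranteeing that all agents are
-- knowledgeable at some time ≤ T from now, whatever Adversary does.
AgentsWinWithin : {k n : ℕ} → Graph n → ℕ → Positions k n → Knowledge k → Set
AgentsWinWithin G ℕ.zero p K = AllKnow K
AgentsWinWithin {k} {n} G (suc t) p K =
  AllKnow K ⊎
  ((H : EdgeSet n) → ConnectedSpanning G H →
     Σ (Positions k n) λ p' → LegalMove H p p' × AgentsWinWithin G t p' (newKnow p' K))

-- Initial knowledge with y knowledgeable agents: agents 0..y-1 are knowledgeable
-- (agents are otherwise indistinguishable, so this labelling is w.l.o.g.).
initKnow : (x y : ℕ) → Knowledge (y Data.Nat.+ x)
initKnow x y a = toℕ a <ᵇ y

{-# OPTIONS --safe #-}
-- On a path every edge is a bridge, so every connected spanning subgraph Adversary may choose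
-- is the whole path: the game reduces to agents moving at most one step per round.
-- Upper bound: cut the path into y segments, each containing exactly one informed agent; a
-- segment avoids the other y - 1 informed agents, so it has at most n - y + 1 vertices and all
-- agents in it meet at its centre within ⌈(n - y)/2⌉ rounds.
-- Lower bound: put the informed agents on 0, ..., y - 1 and an ignorant agent at n - 1.  After
-- t rounds the informed agents are below y + t and that agent is at least at n - 1 - t, so it is
-- still ignorant while y + 2t ≤ n - 1.
module Submission where

open import Defs
open import Data.Bool using (true; false; T; _∨_; _∧_; if_then_else_)
open import Data.Bool.Properties using (T-∨; T-∧; T-≡; ∨-comm)
open import Data.Fin using (Fin; zero; suc; toℕ; fromℕ<; inject₁; _↑ˡ_) renaming (_≟_ to _≟ᶠ_)
open import Data.Fin.Properties
  using (toℕ-injective; toℕ-fromℕ<; fromℕ<-toℕ; toℕ<n; toℕ-inject₁; toℕ-↑ˡ; ↑ˡ-injective; any?; injective⇒≤)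
open import Data.List using (allFin)
open import Data.List.Membership.Propositional.Properties using (∈-allFin)
open import Data.List.Relation.Unary.Any as Any using ()
open import Data.List.Relation.Unary.Any.Properties using (any⁺; any⁻)
open import Data.Nat
  using (ℕ; zero; suc; _+_; _∸_; _≤_; _<_; z≤n; s≤s; s≤s⁻¹; z<s; ⌊_/2⌋; ⌈_/2⌉; ∣_-_∣; _≡ᵇ_; _<ᵇ_; _/_)
open import Data.Nat.DivMod using (m/n≡1+[m∸n]/n)
open import Data.Nat.Properties
open import Data.Product using (Σ; _×_; _,_; proj₁; proj₂)
open import Data.Sum as Sum using (_⊎_; inj₁; inj₂)
open import Data.Unit using (tt)
open import Function.Bundles using (Equivalence)
open import Function.Definitions using (Injective)
open import Relation.Binary using (tri<; tri≈; tri>)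
open import Relation.Binary.Construct.Closure.ReflexiveTransitive using (Star; ε; _◅_; _◅◅_; reverse)
open import Relation.Binary.PropositionalEquality
open import Relation.Nullary using (¬_; yes; no; contradiction)
open import Relation.Nullary.Decidable using (⌊_⌋; toWitness; fromWitness)
open import Relation.Unary using (Decidable)

open Equivalence using (to; from)

⌊n/2⌋≡n/2 : ∀ n → ⌊ n /2⌋ ≡ n / 2
⌊n/2⌋≡n/2 zero          = refl
⌊n/2⌋≡n/2 (suc zero)    = refl
⌊n/2⌋≡n/2 (suc (suc n)) =
  trans (cong suc (⌊n/2⌋≡n/2 n)) (sym (m/n≡1+[m∸n]/n {suc (suc n)} {2} (s≤s (s≤s z≤n))))

m<⌈n/2⌉⇒m+m<n : ∀ {m n} → m < ⌈ n /2⌉ → m + m < n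
m<⌈n/2⌉⇒m+m<n {zero}  {suc n}       _       = z<s
m<⌈n/2⌉⇒m+m<n {suc m} {suc (suc n)} (s≤s h) =
  s≤s (subst (_< suc n) (sym (+-suc m m)) (s≤s (m<⌈n/2⌉⇒m+m<n h)))

∣m-⌊n/2⌋∣≤⌈n/2⌉ : ∀ {m n} → m ≤ n → ∣ m - ⌊ n /2⌋ ∣ ≤ ⌈ n /2⌉
∣m-⌊n/2⌋∣≤⌈n/2⌉ {m} {n} m≤n with ≤-total m ⌊ n /2⌋
... | inj₁ m≤h = begin
  ∣ m - ⌊ n /2⌋ ∣ ≡⟨ m≤n⇒∣m-n∣≡n∸m m≤h ⟩
  ⌊ n /2⌋ ∸ m     ≤⟨ m∸n≤m _ m ⟩
  ⌊ n /2⌋         ≤⟨ ⌊n/2⌋≤⌈n/2⌉ n ⟩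
  ⌈ n /2⌉         ∎
  where open ≤-Reasoning
... | inj₂ h≤m = begin
  ∣ m - ⌊ n /2⌋ ∣             ≡⟨ m≤n⇒∣n-m∣≡n∸m h≤m ⟩
  m ∸ ⌊ n /2⌋                 ≤⟨ ∸-monoˡ-≤ ⌊ n /2⌋ m≤n ⟩
  n ∸ ⌊ n /2⌋                 ≡⟨ cong (_∸ ⌊ n /2⌋) (sym (⌊n/2⌋+⌈n/2⌉≡n n)) ⟩
  ⌊ n /2⌋ + ⌈ n /2⌉ ∸ ⌊ n /2⌋ ≡⟨ m+n∸m≡n ⌊ n /2⌋ ⌈ n /2⌉ ⟩
  ⌈ n /2⌉                     ∎
  where open ≤-Reasoning

segmentCentre : ℕ → ℕ → ℕ
segmentCentre s n = s + ⌊ n ∸ suc s /2⌋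

segmentCentre<n : ∀ {s n} → s < n → segmentCentre s n < n
segmentCentre<n {s} {n} s<n = begin
  suc s + ⌊ n ∸ suc s /2⌋ ≤⟨ +-monoʳ-≤ (suc s) (⌊n/2⌋≤n (n ∸ suc s)) ⟩
  suc s + (n ∸ suc s)     ≡⟨ m+[n∸m]≡n s<n ⟩
  n                       ∎
  where open ≤-Reasoning

segmentCentre-near : ∀ {s v n} → s ≤ v → v < n → ∣ v - segmentCentre s n ∣ ≤ ⌈ n ∸ suc s /2⌉
segmentCentre-near {s} {v} {n} s≤v v<n = begin
  ∣ v - s + ⌊ n ∸ suc s /2⌋ ∣             ≡⟨ cong ∣_- s + ⌊ n ∸ suc s /2⌋ ∣ (sym (m+[n∸m]≡n s≤v)) ⟩
  ∣ s + (v ∸ s) - s + ⌊ n ∸ suc s /2⌋ ∣   ≡⟨ ∣m+n-m+o∣≡∣n-o∣ s (v ∸ s) _ ⟩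
  ∣ v ∸ s - ⌊ n ∸ suc s /2⌋ ∣             ≤⟨ ∣m-⌊n/2⌋∣≤⌈n/2⌉ (∸-monoˡ-≤ (suc s) v<n) ⟩
  ⌈ n ∸ suc s /2⌉                         ∎
  where open ≤-Reasoning

openGap : (y d : ℕ) → ℕ → ℕ
openGap y d u = if u <ᵇ y then u else u + d

openGap-below : ∀ {y d u} → u < y → openGap y d u ≡ u
openGap-below {y} {d} {u} u<y with u <ᵇ y in e
... | true  = refl
... | false = contradiction (subst T e (<⇒<ᵇ u<y)) λ ()

openGap-above : ∀ {y d u} → y ≤ u → openGap y d u ≡ u + d
openGap-above {y} {d} {u} y≤u with u <ᵇ y in e
... | true  = contradiction y≤u (<⇒≱ (<ᵇ⇒< u y (subst T (sym e) tt)))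
... | false = refl

openGap-separates : ∀ {y d u v} → u < y → y ≤ v → openGap y d u ≢ openGap y d v
openGap-separates {y} {d} {u} {v} u<y y≤v e =
  <⇒≢ (<-≤-trans u<y (≤-trans y≤v (m≤m+n v d)))
      (trans (sym (openGap-below u<y)) (trans e (openGap-above y≤v)))

openGap-injective : ∀ {y d} → Injective _≡_ _≡_ (openGap y d)
openGap-injective {y} {d} {u} {v} e with u <? y | v <? y
... | yes u<y | yes v<y = trans (sym (openGap-below u<y)) (trans e (openGap-below v<y))
... | yes u<y | no  v≮y = contradiction e (openGap-separates u<y (≮⇒≥ v≮y))
... | no  u≮y | yes v<y = contradiction (sym e) (openGap-separates v<y (≮⇒≥ u≮y))
... | no  u≮y | no  v≮y =
  +-cancelʳ-≡ d u v (trans (sym (openGap-above (≮⇒≥ u≮y))) (trans e (openGap-above (≮⇒≥ v≮y))))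

MeetsInformed : {k n : ℕ} → Positions k n → Knowledge k → Fin k → Set
MeetsInformed {k} p K a = Σ (Fin k) λ b → K b ≡ true × p b ≡ p a

newKnow≡true⇒MeetsInformed : ∀ {k n} {p : Positions k n} {K} a →
                             newKnow p K a ≡ true → MeetsInformed p K a
newKnow≡true⇒MeetsInformed {k} {p = p} {K} a e with to T-∨ (from T-≡ e)
... | inj₁ Ka = a , to T-≡ Ka , refl
... | inj₂ some with Any.satisfied (any⁻ _ (allFin k) some)
...   | b , Kb∧meet with to (T-∧ {K b}) Kb∧meet
...     | Kb , meet = b , to T-≡ Kb , toWitness meet

MeetsInformed⇒newKnow≡true : ∀ {k n} {p : Positions k n} {K} a →
                             MeetsInformed p K a → newKnow p K a ≡ true
MeetsInformed⇒newKnow≡true {k} {p = p} {K} a (b , Kb , pb≡pa) =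
  to T-≡ (from T-∨ (inj₂ (any⁺ _ (Any.map (λ { refl → Kb∧meet }) (∈-allFin b)))))
  where
    Kb∧meet : T (K b ∧ ⌊ p b ≟ᶠ p a ⌋)
    Kb∧meet = from T-∧ (from T-≡ Kb , fromWitness pb≡pa)

module _ {n : ℕ} {R : Fin n → Fin n → Set} (R⊆Path : ∀ i j → R i j → Path n i j) where

  walk-crosses : ∀ {k u v} → Star R u v → toℕ u ≤ k → k < toℕ v →
                 Σ (Fin n) λ i → Σ (Fin n) λ j → R i j × toℕ i ≡ k × toℕ j ≡ suc k
  walk-crosses ε u≤k k<u = contradiction (≤-<-trans u≤k k<u) (<-irrefl refl)
  walk-crosses {k} {u} (_◅_ {j = w} r ws) u≤k k<v with toℕ w ≤? k
  ... | yes w≤k = walk-crosses ws w≤k k<v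
  ... | no w≰k with R⊆Path u w r
  ...   | inj₁ w≡1+u = u , w , r , u≡k , trans w≡1+u (cong suc u≡k)
    where u≡k = ≤-antisym u≤k (s≤s⁻¹ (subst (k <_) w≡1+u (≰⇒> w≰k)))
  ...   | inj₂ u≡1+w = contradiction (≤-trans (n≤1+n _) (subst (_≤ k) u≡1+w u≤k)) w≰k

StayOrStep : {n : ℕ} → Fin n → Fin n → Set
StayOrStep {n} u v = v ≡ u ⊎ Path n u v

stayOrStep-sym : ∀ {n} {u v : Fin n} → StayOrStep u v → StayOrStep v u
stayOrStep-sym = Sum.map sym Sum.swap

stayOrStep-≤ : ∀ {n} {u v : Fin n} → StayOrStep u v → toℕ v ≤ suc (toℕ u)
stayOrStep-≤ (inj₁ refl)      = n≤1+n _
stayOrStep-≤ (inj₂ (inj₁ e))  = ≤-reflexive e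
stayOrStep-≤ (inj₂ (inj₂ e))  = m<n⇒m≤1+n (≤-reflexive (sym e))

module _ {n : ℕ} {H : EdgeSet n} (H-cs : ConnectedSpanning (Path n) H) where

  private
    H-sym = proj₁ H-cs
    H⊆Path = proj₁ (proj₂ H-cs)
    H-connected = proj₂ (proj₂ H-cs)

  -- A walk in H from i to j must cross the edge between positions toℕ i and toℕ i + 1.
  pathEdge⇒edge : ∀ {i j} → Path n i j → T (H i j)
  pathEdge⇒edge {i} {j} (inj₁ j≡1+i)
    with walk-crosses H⊆Path (H-connected i j) ≤-refl (≤-reflexive (sym j≡1+i))
  ... | a , b , Hab , a≡i , b≡1+i =
    subst₂ (λ a b → T (H a b)) (toℕ-injective a≡i) (toℕ-injective (trans b≡1+i (sym j≡1+i))) Hab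
  pathEdge⇒edge {i} {j} (inj₂ i≡1+j) = subst T (H-sym j i) (pathEdge⇒edge (inj₁ i≡1+j))

  stayOrStep⇒legalMove : ∀ {k} {p p′ : Positions k n} → (∀ a → StayOrStep (p a) (p′ a)) → LegalMove H p p′
  stayOrStep⇒legalMove moves a = Sum.map₂ pathEdge⇒edge (moves a)

  legalMove⇒stayOrStep : ∀ {k} {p p′ : Positions k n} → LegalMove H p p′ → ∀ a → StayOrStep (p a) (p′ a)
  legalMove⇒stayOrStep legal a = Sum.map₂ (H⊆Path _ _) (legal a)

pathEdges : (n : ℕ) → EdgeSet n
pathEdges n i j = (toℕ j ≡ᵇ suc (toℕ i)) ∨ (toℕ i ≡ᵇ suc (toℕ j))

pathEdges-sym : ∀ n (i j : Fin n) → pathEdges n i j ≡ pathEdges n j i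
pathEdges-sym n i j = ∨-comm (toℕ j ≡ᵇ suc (toℕ i)) _

pathEdges⇒Path : ∀ {n} (i j : Fin n) → T (pathEdges n i j) → Path n i j
pathEdges⇒Path i j e = Sum.map (≡ᵇ⇒≡ _ _) (≡ᵇ⇒≡ _ _) (to T-∨ e)

Path⇒pathEdges : ∀ {n} {i j : Fin n} → Path n i j → T (pathEdges n i j)
Path⇒pathEdges e = from T-∨ (Sum.map (≡⇒≡ᵇ _ _) (≡⇒≡ᵇ _ _) e)

pathEdges-connected : ∀ {n} (i j : Fin n) → Star (λ a b → T (pathEdges n a b)) i j
-- Both halves pass through vertex 0; the proof argument of fromℕ< is irrelevant, so they compose.
pathEdges-connected {n} i j =
  reverse (λ {a} {b} → subst T (pathEdges-sym n a b)) (fromFirst i) ◅◅ fromFirst j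
  where
    walk : ∀ m .(m<n : m < n) →
           Star (λ a b → T (pathEdges n a b)) (fromℕ< (≤-<-trans z≤n m<n)) (fromℕ< m<n)
    walk zero    _   = ε
    walk (suc m) m<n = walk m (<-trans (n<1+n m) m<n) ◅◅ (Path⇒pathEdges (inj₁ step) ◅ ε)
      where step = trans (toℕ-fromℕ< m<n) (cong suc (sym (toℕ-fromℕ< (<-trans (n<1+n m) m<n))))
    fromFirst : ∀ a → Star (λ a b → T (pathEdges n a b)) (fromℕ< (≤-<-trans z≤n (toℕ<n a))) a
    fromFirst a = subst (Star _ _) (fromℕ<-toℕ a (toℕ<n a)) (walk (toℕ a) (toℕ<n a))

pathEdges-connectedSpanning : ∀ n → ConnectedSpanning (Path n) (pathEdges n)
pathEdges-connectedSpanning n = pathEdges-sym n , pathEdges⇒Path , pathEdges-connected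

stepTowards : ∀ {n} → Fin n → Fin n → Fin n
stepTowards zero    zero          = zero
stepTowards zero    (suc zero)    = suc zero
stepTowards zero    (suc (suc _)) = suc zero
stepTowards (suc v) zero          = inject₁ v
stepTowards (suc v) (suc c)       = suc (stepTowards v c)

stepTowards-stayOrStep : ∀ {n} (v c : Fin n) → StayOrStep v (stepTowards v c)
stepTowards-stayOrStep zero    zero          = inj₁ refl
stepTowards-stayOrStep zero    (suc zero)    = inj₂ (inj₁ refl)
stepTowards-stayOrStep zero    (suc (suc _)) = inj₂ (inj₁ refl)
stepTowards-stayOrStep (suc v) zero          = inj₂ (inj₂ (cong suc (sym (toℕ-inject₁ v))))
stepTowards-stayOrStep (suc v) (suc c)       =
  Sum.map (cong suc) (Sum.map (cong suc) (cong suc)) (stepTowards-stayOrStep v c)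

stepTowards-closer : ∀ {n d} (v c : Fin n) →
                     ∣ toℕ v - toℕ c ∣ ≤ suc d → ∣ toℕ (stepTowards v c) - toℕ c ∣ ≤ d
stepTowards-closer zero    zero          _ = z≤n
stepTowards-closer zero    (suc zero)    _ = z≤n
stepTowards-closer zero    (suc (suc c)) h = s≤s⁻¹ h
stepTowards-closer (suc v) zero          h =
  ≤-trans (≤-reflexive (trans (∣-∣-identityʳ _) (toℕ-inject₁ v))) (s≤s⁻¹ h)
stepTowards-closer (suc v) (suc c)       h = stepTowards-closer v c h

module _ {k n : ℕ} (c : Positions k n) where

  towardsTargets : Positions k n → Positions k n
  towardsTargets p a = stepTowards (p a) (c a)

  towardsTargets-legal : ∀ {H} → ConnectedSpanning (Path n) H →
                         (p : Positions k n) → LegalMove H p (towardsTargets p)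
  towardsTargets-legal H-cs p = stayOrStep⇒legalMove H-cs (λ a → stepTowards-stayOrStep (p a) (c a))

  walkTowards : ∀ {t} (p : Positions k n) (K : Knowledge k) → 0 < t →
                (∀ a → ∣ toℕ (p a) - toℕ (c a) ∣ ≤ t) → (∀ a → MeetsInformed c K a) →
                AgentsWinWithin (Path n) t p K
  walkTowards {zero} _ _ () _ _
  walkTowards {suc zero} p K _ near informed =
    inj₂ λ H H-cs → towardsTargets p , towardsTargets-legal H-cs p , allKnow
    where
      arrived : ∀ a → towardsTargets p a ≡ c a
      arrived a = toℕ-injective (∣m-n∣≡0⇒m≡n (n≤0⇒n≡0 (stepTowards-closer (p a) (c a) (near a))))
      allKnow : AllKnow (newKnow (towardsTargets p) K)
      allKnow a with informed a
      ... | b , Kb , cb≡ca =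
        MeetsInformed⇒newKnow≡true a (b , Kb , trans (arrived b) (trans cb≡ca (sym (arrived a))))
  walkTowards {suc (suc t)} p K _ near informed =
    inj₂ λ H H-cs → towardsTargets p , towardsTargets-legal H-cs p ,
      walkTowards (towardsTargets p) (newKnow (towardsTargets p) K) z<s
        (λ a → stepTowards-closer (p a) (c a) (near a)) stillInformed
    where
      stillInformed : ∀ a → MeetsInformed c (newKnow (towardsTargets p) K) a
      stillInformed a with informed a
      ... | b , Kb , cb≡ca =
        b , MeetsInformed⇒newKnow≡true {p = towardsTargets p} {K} b (b , Kb , refl) , cb≡ca

module Marks {K : ℕ → Set} (K? : Decidable K) where

  count : ℕ → ℕ
  count zero = zero
  count (suc v) with K? v
  ... | yes _ = suc (count v)
  ... | no  _ = count v

  count≤ : ∀ v → count v ≤ v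
  count≤ zero = z≤n
  count≤ (suc v) with K? v
  ... | yes _ = s≤s (count≤ v)
  ... | no  _ = m≤n⇒m≤1+n (count≤ v)

  count≤count-suc : ∀ v → count v ≤ count (suc v)
  count≤count-suc v with K? v
  ... | yes _ = n≤1+n _
  ... | no  _ = ≤-refl

  count-mono : ∀ {u v} → u ≤ v → count u ≤ count v
  count-mono {v = zero}  z≤n = ≤-refl
  count-mono {u} {suc v} u≤1+v with m≤n⇒m<n∨m≡n u≤1+v
  ... | inj₁ u<1+v = ≤-trans (count-mono (s≤s⁻¹ u<1+v)) (count≤count-suc v)
  ... | inj₂ refl  = ≤-refl

  count-suc-mark : ∀ {u} → K u → count (suc u) ≡ suc (count u)
  count-suc-mark {u} Ku with K? u
  ... | yes _  = refl
  ... | no ¬Ku = contradiction Ku ¬Ku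

  count-<-mark : ∀ {u v} → K u → u < v → count u < count v
  count-<-mark Ku u<v = subst (_≤ _) (count-suc-mark Ku) (count-mono u<v)

  count-injective-on-marks : ∀ {u v} → K u → K v → count u ≡ count v → u ≡ v
  count-injective-on-marks {u} {v} Ku Kv e with <-cmp u v
  ... | tri< u<v _ _ = contradiction e (<⇒≢ (count-<-mark Ku u<v))
  ... | tri≈ _ u≡v _ = u≡v
  ... | tri> _ _ v<u = contradiction (sym e) (<⇒≢ (count-<-mark Kv v<u))

  injection⇒≤count : ∀ {y n} (q : Fin y → ℕ) → Injective _≡_ _≡_ q →
                     (∀ i → K (q i)) → (∀ i → q i < n) → y ≤ count n
  injection⇒≤count {y} {n} q q-injective marked q<n = injective⇒≤ rank-injective
    where
      rank : Fin y → Fin (count n)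
      rank i = fromℕ< (count-<-mark (marked i) (q<n i))
      rank-injective : Injective _≡_ _≡_ rank
      rank-injective {i} {j} e = q-injective (count-injective-on-marks (marked i) (marked j)
        (trans (sym (toℕ-fromℕ< _)) (trans (cong toℕ e) (toℕ-fromℕ< _))))

  count≡1+m⇒mark : ∀ {n m} → count n ≡ suc m → Σ ℕ λ r → r < n × K r × count r ≡ m
  count≡1+m⇒mark {zero} ()
  count≡1+m⇒mark {suc n} e with K? n
  ... | yes Kn = n , n<1+n n , Kn , suc-injective e
  ... | no  _  with count≡1+m⇒mark e
  ...   | r , r<n , Kr , count-r = r , m<n⇒m<1+n r<n , Kr , count-r

  record Gathering (n radius : ℕ) : Set where
    field
      target        : ℕ → ℕ
      target<n      : ∀ {v} → v < n → target v < n
      target-near   : ∀ {v} → v < n → ∣ v - target v ∣ ≤ radius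
      target-marked : ∀ {v} → v < n → Σ ℕ λ r → r < n × K r × target r ≡ target v

  -- With marks r₁ < … < r_M below n, the segments [0, r₂), [r₂, r₃), …, [r_M, n) each contain
  -- exactly one mark and avoid the other M - 1, so each has at most n - M + 1 points.
  gatheringOfCount : ∀ m n → count n ≡ suc m → Gathering n ⌈ n ∸ suc m /2⌉
  gatheringOfCount zero n e with count≡1+m⇒mark e
  ... | r , r<n , Kr , _ = record
    { target        = λ _ → segmentCentre 0 n
    ; target<n      = λ _ → segmentCentre<n (≤-<-trans z≤n r<n)
    ; target-near   = segmentCentre-near z≤n
    ; target-marked = λ _ → r , r<n , Kr , refl
    }
  gatheringOfCount (suc m) n e with count≡1+m⇒mark e
  ... | r , r<n , Kr , count-r = record
    { target        = target
    ; target<n      = target<n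
    ; target-near   = target-near
    ; target-marked = target-marked
    }
    where
      module G = Gathering (gatheringOfCount m r count-r)

      target : ℕ → ℕ
      target v with v <? r
      ... | yes _ = G.target v
      ... | no  _ = segmentCentre r n

      target-below : ∀ {v} → v < r → target v ≡ G.target v
      target-below {v} v<r with v <? r
      ... | yes _   = refl
      ... | no  v≮r = contradiction v<r v≮r

      target-r : target r ≡ segmentCentre r n
      target-r with r <? r
      ... | yes r<r = contradiction r<r (<-irrefl refl)
      ... | no  _   = refl

      target<n : ∀ {v} → v < n → target v < n
      target<n {v} v<n with v <? r
      ... | yes v<r = <-trans (G.target<n v<r) r<n
      ... | no  _   = segmentCentre<n r<n

      target-near : ∀ {v} → v < n → ∣ v - target v ∣ ≤ ⌈ n ∸ suc (suc m) /2⌉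
      target-near {v} v<n with v <? r
      ... | yes v<r = ≤-trans (G.target-near v<r) (⌈n/2⌉-mono (∸-monoˡ-≤ (suc (suc m)) r<n))
      ... | no  v≮r = ≤-trans (segmentCentre-near (≮⇒≥ v≮r) v<n) (⌈n/2⌉-mono (∸-monoʳ-≤ n (s≤s m<r)))
        where m<r = subst (_≤ r) count-r (count≤ r)

      target-marked : ∀ {v} → v < n → Σ ℕ λ r → r < n × K r × target r ≡ target v
      target-marked {v} v<n with v <? r
      ... | yes v<r with G.target-marked v<r
      ...   | r′ , r′<r , Kr′ , e′ =
        r′ , <-trans r′<r r<n , Kr′ , trans (target-below r′<r) e′
      target-marked {v} v<n | no _ = r , r<n , Kr , target-r

  gathering : ∀ {n} → 0 < count n → Gathering n ⌈ n ∸ count n /2⌉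
  gathering {n} 0<count with count n in e
  ... | suc m = gatheringOfCount m n e

initKnow-↑ˡ : ∀ {x y} (i : Fin y) → initKnow x y (i ↑ˡ x) ≡ true
initKnow-↑ˡ {x} {y} i = to T-≡ (subst (λ m → T (m <ᵇ y)) (sym (toℕ-↑ˡ i x)) (<⇒<ᵇ (toℕ<n i)))

upperBound : ∀ {n x y} → 1 ≤ x → 1 ≤ y → x + y ≤ n →
             (p : Fin (y + x) → Fin n) → Injective _≡_ _≡_ p →
             AgentsWinWithin (Path n) ⌈ n ∸ y /2⌉ p (initKnow x y)
upperBound {n} {x} {y} 1≤x 1≤y x+y≤n p p-injective =
  walkTowards c p (initKnow x y) 0<radius near informed
  where
    q : Fin y → ℕ
    q i = toℕ (p (i ↑ˡ x))

    q-injective : Injective _≡_ _≡_ q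
    q-injective e = ↑ˡ-injective x _ _ (p-injective (toℕ-injective e))

    open Marks (λ v → any? λ i → q i ≟ v)

    y≤count : y ≤ count n
    y≤count = injection⇒≤count q q-injective (λ i → i , refl) (λ i → toℕ<n (p (i ↑ˡ x)))

    open Gathering (gathering {n} (≤-trans 1≤y y≤count))

    c : Fin (y + x) → Fin n
    c a = fromℕ< (target<n (toℕ<n (p a)))

    toℕ-c : ∀ a → toℕ (c a) ≡ target (toℕ (p a))
    toℕ-c a = toℕ-fromℕ< _

    0<radius : 0 < ⌈ n ∸ y /2⌉
    0<radius = ⌈n/2⌉-mono (≤-trans 1≤x (m+n≤o⇒m≤o∸n x x+y≤n))

    near : ∀ a → ∣ toℕ (p a) - toℕ (c a) ∣ ≤ ⌈ n ∸ y /2⌉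
    near a rewrite toℕ-c a = ≤-trans (target-near (toℕ<n (p a))) (⌈n/2⌉-mono (∸-monoʳ-≤ n y≤count))

    informed : ∀ a → MeetsInformed c (initKnow x y) a
    informed a with target-marked (toℕ<n (p a))
    ... | _ , _ , (i , refl) , e =
      i ↑ˡ x , initKnow-↑ˡ i , toℕ-injective (trans (toℕ-c _) (trans e (sym (toℕ-c a))))

-- Adversary always keeps the whole path; each round the bound M on informed positions grows
-- by one and z moves down by at most one.
farFromInformed⇒¬AgentsWinWithin :
  ∀ {k n} t (p : Positions k n) (K : Knowledge k) z M → K z ≢ true →
  (∀ a → K a ≡ true → toℕ (p a) < M) → M + (t + t) ≤ toℕ (p z) →
  ¬ AgentsWinWithin (Path n) t p K
farFromInformed⇒¬AgentsWinWithin zero    p K z M ignorant _ _ allKnow = ignorant (allKnow z)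
farFromInformed⇒¬AgentsWinWithin (suc t) p K z M ignorant _ _ (inj₁ allKnow) = ignorant (allKnow z)
farFromInformed⇒¬AgentsWinWithin {k} {n} (suc t) p K z M ignorant below far (inj₂ strategy)
  with strategy (pathEdges n) (pathEdges-connectedSpanning n)
... | p′ , legal , win =
  farFromInformed⇒¬AgentsWinWithin t p′ (newKnow p′ K) z (suc M) ignorant′ below′ far′ win
  where
    moved : ∀ a → StayOrStep (p a) (p′ a)
    moved = legalMove⇒stayOrStep (pathEdges-connectedSpanning n) legal

    below′ : ∀ a → newKnow p′ K a ≡ true → toℕ (p′ a) < suc M
    below′ a e with newKnow≡true⇒MeetsInformed a e
    ... | b , Kb , p′b≡p′a =
      subst (λ w → toℕ w < suc M) p′b≡p′a (s≤s (≤-trans (stayOrStep-≤ (moved b)) (below b Kb)))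

    far′ : suc M + (t + t) ≤ toℕ (p′ z)
    far′ = s≤s⁻¹ (begin
      suc (suc M + (t + t))   ≡⟨ cong suc (sym (+-suc M (t + t))) ⟩
      suc (M + suc (t + t))   ≡⟨ sym (+-suc M (suc (t + t))) ⟩
      M + suc (suc (t + t))   ≡⟨ cong (λ w → M + suc w) (sym (+-suc t t)) ⟩
      M + (suc t + suc t)     ≤⟨ far ⟩
      toℕ (p z)               ≤⟨ stayOrStep-≤ (stayOrStep-sym (moved z)) ⟩
      suc (toℕ (p′ z))        ∎)
      where open ≤-Reasoning

    ignorant′ : newKnow p′ K z ≢ true
    ignorant′ e = <⇒≱ (below′ z e) (≤-trans (m≤m+n (suc M) (t + t)) far′)

lastAgent : ∀ y x′ → Fin (y + suc x′)
lastAgent y x′ = fromℕ< (+-monoʳ-< y (n<1+n x′))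

toℕ-lastAgent : ∀ y x′ → toℕ (lastAgent y x′) ≡ y + x′
toℕ-lastAgent y x′ = toℕ-fromℕ< _

lastAgent-ignorant : ∀ y x′ → initKnow (suc x′) y (lastAgent y x′) ≢ true
lastAgent-ignorant y x′ e = <⇒≱ (<ᵇ⇒< _ _ (from T-≡ e)) (subst (y ≤_) (sym (toℕ-lastAgent y x′)) (m≤m+n y x′))

module _ (y x′ d : ℕ) where

  private
    n = y + suc x′ + d

  openGap<n : ∀ (a : Fin (y + suc x′)) → openGap y d (toℕ a) < n
  openGap<n a with toℕ a <? y
  ... | yes a<y = subst (_< n) (sym (openGap-below a<y)) (<-≤-trans (toℕ<n a) (m≤m+n (y + suc x′) d))
  ... | no  a≮y = subst (_< n) (sym (openGap-above (≮⇒≥ a≮y))) (+-monoˡ-< d (toℕ<n a))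

  gapPlacement : Fin (y + suc x′) → Fin n
  gapPlacement a = fromℕ< (openGap<n a)

  toℕ-gapPlacement : ∀ a → toℕ (gapPlacement a) ≡ openGap y d (toℕ a)
  toℕ-gapPlacement a = toℕ-fromℕ< _

  gapPlacement-injective : Injective _≡_ _≡_ gapPlacement
  gapPlacement-injective {a} {b} e = toℕ-injective (openGap-injective {y} {d}
    (trans (sym (toℕ-gapPlacement a)) (trans (cong toℕ e) (toℕ-gapPlacement b))))

  gapPlacement-informed : ∀ a → initKnow (suc x′) y a ≡ true → toℕ (gapPlacement a) < y
  gapPlacement-informed a e = subst (_< y) (sym (trans (toℕ-gapPlacement a) (openGap-below a<y))) a<y
    where a<y = <ᵇ⇒< _ _ (from T-≡ e)

  gapPlacement-lastAgent : toℕ (gapPlacement (lastAgent y x′)) ≡ y + x′ + d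
  gapPlacement-lastAgent = begin
    toℕ (gapPlacement (lastAgent y x′)) ≡⟨ toℕ-gapPlacement (lastAgent y x′) ⟩
    openGap y d (toℕ (lastAgent y x′))   ≡⟨ cong (openGap y d) (toℕ-lastAgent y x′) ⟩
    openGap y d (y + x′)                 ≡⟨ openGap-above (m≤m+n y x′) ⟩
    y + x′ + d                           ∎
    where open ≡-Reasoning

lowerBound : ∀ {n x y} → 1 ≤ x → x + y ≤ n →
             Σ (Fin (y + x) → Fin n) λ p → Injective _≡_ _≡_ p ×
               ((t : ℕ) → t < ⌈ n ∸ y /2⌉ → ¬ AgentsWinWithin (Path n) t p (initKnow x y))
lowerBound {n} {suc x′} {y} _ x+y≤n with m≤n⇒∃[o]m+o≡n (subst (_≤ n) (+-comm (suc x′) y) x+y≤n)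
... | d , refl = gapPlacement y x′ d , gapPlacement-injective y x′ d , λ t t<radius →
  farFromInformed⇒¬AgentsWinWithin t (gapPlacement y x′ d) (initKnow (suc x′) y) (lastAgent y x′) y
    (lastAgent-ignorant y x′) (gapPlacement-informed y x′ d) (lastAgent-far t<radius)
  where
    lastAgent-far : ∀ {t} → t < ⌈ y + suc x′ + d ∸ y /2⌉ →
                    y + (t + t) ≤ toℕ (gapPlacement y x′ d (lastAgent y x′))
    lastAgent-far {t} t<radius = begin
      y + (t + t)   ≤⟨ +-monoʳ-≤ y (s≤s⁻¹ (subst (t + t <_) remaining (m<⌈n/2⌉⇒m+m<n t<radius))) ⟩
      y + (x′ + d)  ≡⟨ sym (+-assoc y x′ d) ⟩
      y + x′ + d    ≡⟨ sym (gapPlacement-lastAgent y x′ d) ⟩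
      toℕ (gapPlacement y x′ d (lastAgent y x′)) ∎
      where
        open ≤-Reasoning
        remaining : y + suc x′ + d ∸ y ≡ suc x′ + d
        remaining = trans (cong (_∸ y) (+-assoc y (suc x′) d)) (m+n∸m≡n y (suc x′ + d))

mainTheorem8 : (n x y : ℕ) → 1 ≤ x → 1 ≤ y → x + y ≤ n →
    -- upper bound: from every placement, Agents win within ⌈(n-y)/2⌉ rounds
    (((p : Fin (y + x) → Fin n) → Injective _≡_ _≡_ p →
        AgentsWinWithin (Path n) (suc (n ∸ y) / 2) p (initKnow x y))
    ×
    -- lower bound: some placement prevents Agents from winning in fewer rounds
    Σ (Fin (y + x) → Fin n) λ p → Injective _≡_ _≡_ p ×
        ((t : ℕ) → t < suc (n ∸ y) / 2 →
          ¬ AgentsWinWithin (Path n) t p (initKnow x y)))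
mainTheorem8 n x y 1≤x 1≤y x+y≤n rewrite sym (⌊n/2⌋≡n/2 (suc (n ∸ y))) =
  upperBound 1≤x 1≤y x+y≤n , lowerBound 1≤x x+y≤n
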